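{- Let $V=[n]$, $k\ge1$, $\varepsilon\in(0,1)$, $B\le n$ a positive integer, and let $F:(k+1)^V\to\mathbb{R}_{\ge0}$ be $\varepsilon$-approximately $k$-submodular with witness $f$ (a monotone $k$-submodular function with $f(\mathbf{0})=0$ and $(1-\varepsilon)f\le F\le(1+\varepsilon)f$ pointwise). Let $\mathbf{x}^{(0)},\dots,\mathbf{x}^{(B)}$ and $(e^{(j)},i^{(j)})$ be the iterates and selected pairs of $k$-Greedy-TS run on $F$, let $\mathbf{o}\in\arg\max_{|\mathrm{supp}(\mathbf{y})|\le B}F(\mathbf{y})$ with $|\mathrm{supp}(\mathbf{o})|=B$, and let $\mathbf{o}^{(0)},\mathbf{o}^{(1/2)},\mathbf{o}^{(1)},\dots,\mathbf{o}^{(B)}$ be constructed as described in the context. Then for every $j\in[B]$, $\frac{1+\varepsilon}{1-\varepsilon}f(\mathbf{x}^{(j)})-f(\mathbf{x}^{(j-1)})\ge f(\mathbf{o}^{(j-1)})-f(\mathbf{o}^{(j)})$.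
   Context: $(k+1)^V$ is the set of $k$-tuples $(X_1,\dots,X_k)$ of pairwise disjoint subsets of $V$, identified with $\mathbf{x}\in\{0,\dots,k\}^V$ via $\mathbf{x}(e)=i\iff e\in X_i$; $\mathrm{supp}(\mathbf{x})=\{e:\mathbf{x}(e)\ne0\}$; $\mathbf{x}\preceq\mathbf{y}$ iff $X_i\subseteq Y_i$ $\forall i$; $\Delta_{u,i}g(\mathbf{x})=g(X_1,\dots,X_i\cup\{u\},\dots,X_k)-g(\mathbf{x})$. $k$-submodular: $\Delta_{u,i}f(\mathbf{x})\ge\Delta_{u,i}f(\mathbf{y})$ for $\mathbf{x}\preceq\mathbf{y}$, $u\notin\mathrm{supp}(\mathbf{y})$, and $\Delta_{u,i}f(\mathbf{x})+\Delta_{u,j}f(\mathbf{x})\ge0$ for $i\ne j$; monotone: $\mathbf{x}\preceq\mathbf{y}\Rightarrow f(\mathbf{x})\le f(\mathbf{y})$. $F(\mathbf{0})=0$. $k$-Greedy-TS: $\mathbf{x}^{(0)}=\mathbf{0}$; for $j=1,\dots,B$, $(e^{(j)},i^{(j)})\in\arg\max_{e\notin\mathrm{supp}(\mathbf{x}^{(j-1)}),i\in[k]}\Delta_{e,i}F(\mathbf{x}^{(j-1)})$ and $\mathbf{x}^{(j)}$ is $\mathbf{x}^{(j-1)}$ with $e^{(j)}$ assigned value $i^{(j)}$. Construction: $\mathbf{o}^{(0)}=\mathbf{o}$. For $j=1,\dots,B$, let $S^{(j)}=\mathrm{supp}(\mathbf{o}^{(j-1)})\setminus\mathrm{supp}(\mathbf{x}^{(j-1)})$;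 let $u_j=e^{(j)}$ if $e^{(j)}\in S^{(j)}$, and otherwise let $u_j$ be an arbitrary element of $S^{(j)}$; $\mathbf{o}^{(j-1/2)}$ is $\mathbf{o}^{(j-1)}$ with the $u_j$-th coordinate set to $0$; $\mathbf{o}^{(j)}$ is $\mathbf{o}^{(j-1/2)}$ with the $e^{(j)}$-th coordinate set to $i^{(j)}$. (Then $|\mathrm{supp}(\mathbf{o}^{(j)})|=B$, $\mathbf{x}^{(j-1)}\preceq\mathbf{o}^{(j-1/2)}$, and $\mathbf{o}^{(B)}=\mathbf{x}^{(B)}$.) -}

module Defs where

open import Data.Product using (_×_)
open import Data.Nat using (ℕ) renaming (suc to 1+)
open import Data.Fin using (Fin; zero; suc; _≟_)
open import Data.Fin.Subset using (Subset; ∣_∣)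
open import Data.Vec using (tabulate)
open import Data.Bool using (Bool; true; false)
open import Relation.Nullary using (¬_; yes; no)
open import Relation.Binary.PropositionalEquality using (_≡_)
open import Relation.Binary.Structures using (IsTotalOrder)
open import Algebra.Structures using (IsCommutativeRing)

-- The reals ℝ are an instance; the statement is proved for every ordered field.
-- Inverse is total; the axiom only constrains it on nonzero elements.
record OrderedField : Set₁ where
  infixl 6 _+_ _-_
  infixl 7 _*_
  infix 4 _≤_ _<_
  field
    Carrier : Set
    _+_ _*_ : Carrier → Carrier → Carrier
    -_ _⁻¹ : Carrier → Carrier
    0# 1# : Carrier
    _≤_ : Carrier → Carrier → Set
    isCommutativeRing : IsCommutativeRing _≡_ _+_ _*_ -_ 0# 1#
    isTotalOrder : IsTotalOrder _≡_ _≤_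
    0≢1 : ¬ (0# ≡ 1#)
    ⁻¹-inverse : ∀ x → ¬ (x ≡ 0#) → x * (x ⁻¹) ≡ 1#
    +-mono-≤ : ∀ {x y} z → x ≤ y → x + z ≤ y + z
    *-nonneg : ∀ {x y} → 0# ≤ x → 0# ≤ y → 0# ≤ x * y

  _-_ : Carrier → Carrier → Carrier
  x - y = x + (- y)

  _<_ : Carrier → Carrier → Set
  x < y = (x ≤ y) × ¬ (x ≡ y)

-- Elements of (k+1)^V with V = [n] = Fin n: a vector x : Fin n → Fin (suc k),
-- where x e = zero means e ∉ supp x and x e = suc i means e ∈ X_(i+1).
Orth : ℕ → ℕ → Set
Orth n k = Fin n → Fin (1+ k)

𝟎 : ∀ {n k} → Orth n k
𝟎 _ = zero

_[_≔_] : ∀ {n k} → Orth n k → Fin n → Fin (1+ k) → Orth n k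
(x [ u ≔ v ]) e with e ≟ u
... | yes _ = v
... | no _ = x e

supp : ∀ {n k} → Orth n k → Subset n
supp x = tabulate λ e → isNZ (x e)
  where
  isNZ : ∀ {k} → Fin (1+ k) → Bool
  isNZ zero = false
  isNZ (suc _) = true

∣supp∣ : ∀ {n k} → Orth n k → ℕ
∣supp∣ x = ∣ supp x ∣

-- x ≼ y  iff  X_i ⊆ Y_i for all i
_≼_ : ∀ {n k} → Orth n k → Orth n k → Set
x ≼ y = ∀ e → ¬ (x e ≡ zero) → y e ≡ x e

module _ (𝔽 : OrderedField) where
  open OrderedField 𝔽

  -- Δ_{u,i} g(x), with i ∈ [k] represented by i : Fin k (value suc i)
  Δ : ∀ {n k} → (Orth n k → Carrier) → Fin n → Fin k → Orth n k → Carrier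
  Δ g u i x = g (x [ u ≔ suc i ]) - g x

  -- k-submodularity (marginals only for u ∉ supp, where they are defined)
  IsKSubmodular : ∀ {n k} → (Orth n k → Carrier) → Set
  IsKSubmodular {n} {k} f =
    ((x y : Orth n k) → x ≼ y → (u : Fin n) → y u ≡ zero → (i : Fin k) →
       Δ f u i y ≤ Δ f u i x)
    × ((x : Orth n k) → (u : Fin n) → x u ≡ zero → (i j : Fin k) → ¬ (i ≡ j) →
       0# ≤ Δ f u i x + Δ f u j x)

  IsMonotone : ∀ {n k} → (Orth n k → Carrier) → Set
  IsMonotone {n} {k} f = (x y : Orth n k) → x ≼ y → f x ≤ f y

{-# OPTIONS --safe #-}
-- Write h = o^(j-1/2) and let i+1 be the value of the removed element u = u_j in o^(j-1),
-- so that o^(j-1) = h[u ≔ i+1] and h ≼ o^(j). Inductively x^(j-1) ≼ o^(j-1) with u outside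
-- supp x^(j-1), hence x^(j-1) ≼ h, and diminishing returns give
--   f(o^(j-1)) - f(o^(j)) ≤ Δ_{u,i} f(h) ≤ Δ_{u,i} f(x^(j-1)).
-- Greedy optimality gives F(x^(j-1)[u ≔ i+1]) ≤ F(x^(j)), and sandwiching F between
-- (1-ε)f and (1+ε)f turns this into f(x^(j-1)[u ≔ i+1]) ≤ (1+ε)/(1-ε) · f(x^(j)).
module Submission where

open import Defs
open import Data.Nat using (ℕ; suc)
open import Data.Nat as Nat using ()
open import Data.Nat.Properties using (<⇒≤)
open import Data.Fin using (Fin; zero) renaming (suc to fsuc)
open import Data.Fin as Fin using ()
open import Data.Product using (_×_; _,_; proj₁; proj₂; ∃)
open import Data.Sum using (inj₁; inj₂)
open import Relation.Nullary using (¬_; yes; no; contradiction)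
open import Relation.Binary.Bundles using (Poset)
open import Relation.Binary.PropositionalEquality
  using (_≡_; _≢_; _≗_; refl; sym; trans; cong; subst; subst₂; module ≡-Reasoning)
open import Relation.Binary.Structures using (IsTotalOrder)
open import Algebra.Bundles using (CommutativeRing)
import Algebra.Properties.Group as GroupProperties
import Algebra.Properties.Ring as RingProperties
import Relation.Binary.Reasoning.PartialOrder as ≤-Reasoning

module OrderedFieldProperties (𝔽 : OrderedField) where
  open OrderedField 𝔽

  commutativeRing : CommutativeRing _ _
  commutativeRing = record { isCommutativeRing = isCommutativeRing }

  open CommutativeRing commutativeRing
    using (ring; +-group; +-comm; +-identityˡ; -‿inverseˡ; -‿inverseʳ; *-assoc; *-comm; *-identityʳ)
  open GroupProperties +-group using (\\-leftDividesˡ; //-rightDividesˡ; x∙y⁻¹≈ε⇒x≈y)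
  open RingProperties ring using (-‿distribʳ-*; -1*x≈-x; -‿involutive; -0#≈0#; [y-z]x≈yx-zx)
  open IsTotalOrder isTotalOrder public using (total; antisym) renaming (trans to ≤-trans)

  poset : Poset _ _ _
  poset = record { isPartialOrder = IsTotalOrder.isPartialOrder isTotalOrder }

  neg-antimono-≤ : ∀ {x y} → x ≤ y → - y ≤ - x
  neg-antimono-≤ {x} {y} x≤y = subst₂ _≤_ (\\-leftDividesˡ x (- y)) y-x-y≡-x (+-mono-≤ (- x - y) x≤y)
    where
    y-x-y≡-x : y + (- x - y) ≡ - x
    y-x-y≡-x = trans (cong (y +_) (+-comm (- x) (- y))) (\\-leftDividesˡ y (- x))

  -‿antimonoʳ-≤ : ∀ z {x y} → x ≤ y → z - y ≤ z - x
  -‿antimonoʳ-≤ z x≤y = subst₂ _≤_ (+-comm _ z) (+-comm _ z) (+-mono-≤ z (neg-antimono-≤ x≤y))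

  x≤y⇒0≤y-x : ∀ {x y} → x ≤ y → 0# ≤ y - x
  x≤y⇒0≤y-x {x} x≤y = subst (_≤ _) (-‿inverseʳ x) (+-mono-≤ (- x) x≤y)

  x-z≤y-z⇒x≤y : ∀ {x y} z → x - z ≤ y - z → x ≤ y
  x-z≤y-z⇒x≤y {x} {y} z p = subst₂ _≤_ (//-rightDividesˡ z x) (//-rightDividesˡ z y) (+-mono-≤ z p)

  *-monoˡ-≤-nonNeg : ∀ {x y z} → 0# ≤ z → x ≤ y → x * z ≤ y * z
  *-monoˡ-≤-nonNeg {x} {y} {z} 0≤z x≤y =
    subst₂ _≤_ (+-identityˡ (x * z)) (//-rightDividesˡ (x * z) (y * z)) (+-mono-≤ (x * z) 0≤yz-xz)
    where
    0≤yz-xz : 0# ≤ y * z - x * z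
    0≤yz-xz = subst (0# ≤_) ([y-z]x≈yx-zx z y x) (*-nonneg (x≤y⇒0≤y-x x≤y) 0≤z)

  0≤1 : 0# ≤ 1#
  0≤1 with total 0# 1#
  ... | inj₁ 0≤1 = 0≤1
  ... | inj₂ 1≤0 = subst (0# ≤_) -1*-1≡1 (*-nonneg 0≤-1 0≤-1)
    where
    0≤-1 : 0# ≤ - 1#
    0≤-1 = subst (_≤ - 1#) -0#≈0# (neg-antimono-≤ 1≤0)
    -1*-1≡1 : - 1# * - 1# ≡ 1#
    -1*-1≡1 = trans (-1*x≈-x (- 1#)) (-‿involutive 1#)

  0≰-1 : ¬ (0# ≤ - 1#)
  0≰-1 0≤-1 = 0≢1 (antisym 0≤1 (subst₂ _≤_ (+-identityˡ 1#) (-‿inverseˡ 1#) (+-mono-≤ 1# 0≤-1)))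

  ⁻¹-nonNeg : ∀ {x} → x ≢ 0# → 0# ≤ x → 0# ≤ x ⁻¹
  ⁻¹-nonNeg {x} x≢0 0≤x with total 0# (x ⁻¹)
  ... | inj₁ 0≤x⁻¹ = 0≤x⁻¹
  ... | inj₂ x⁻¹≤0 = contradiction 0≤-1 0≰-1
    where
    0≤-1 : 0# ≤ - 1#
    0≤-1 = subst (0# ≤_) (trans (sym (-‿distribʳ-* x (x ⁻¹))) (cong -_ (⁻¹-inverse x x≢0)))
             (*-nonneg 0≤x (subst (_≤ - (x ⁻¹)) -0#≈0# (neg-antimono-≤ x⁻¹≤0)))

  *-cancelˡ-≤-pos : ∀ {d p a b} → d ≢ 0# → 0# ≤ d → d * a ≤ p * b → a ≤ (p * d ⁻¹) * b
  *-cancelˡ-≤-pos {d} {p} {a} {b} d≢0 0≤d da≤pb =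
    subst₂ _≤_ da/d≡a pb/d≡p/d*b (*-monoˡ-≤-nonNeg (⁻¹-nonNeg d≢0 0≤d) da≤pb)
    where
    da/d≡a : d * a * d ⁻¹ ≡ a
    da/d≡a = begin
      d * a * d ⁻¹   ≡⟨ cong (_* d ⁻¹) (*-comm d a) ⟩
      a * d * d ⁻¹   ≡⟨ *-assoc a d (d ⁻¹) ⟩
      a * (d * d ⁻¹) ≡⟨ cong (a *_) (⁻¹-inverse d d≢0) ⟩
      a * 1#         ≡⟨ *-identityʳ a ⟩
      a              ∎
      where open ≡-Reasoning
    pb/d≡p/d*b : p * b * d ⁻¹ ≡ p * d ⁻¹ * b
    pb/d≡p/d*b =
      trans (*-assoc p b (d ⁻¹)) (trans (cong (p *_) (*-comm b (d ⁻¹))) (sym (*-assoc p (d ⁻¹) b)))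

  1-x≢0 : ∀ {x} → x ≢ 1# → 1# - x ≢ 0#
  1-x≢0 {x} x≢1 1-x≡0 = x≢1 (sym (x∙y⁻¹≈ε⇒x≈y 1# x 1-x≡0))

  approximation-transfers-≤ : ∀ {A : Set} {F f : A → Carrier} {ε} → ε < 1# →
    (∀ y → (1# - ε) * f y ≤ F y × F y ≤ (1# + ε) * f y) →
    ∀ {y z} → F y ≤ F z → f y ≤ ((1# + ε) * (1# - ε) ⁻¹) * f z
  approximation-transfers-≤ (ε≤1 , ε≢1) approx {y} {z} Fy≤Fz =
    *-cancelˡ-≤-pos (1-x≢0 ε≢1) (x≤y⇒0≤y-x ε≤1)
      (≤-trans (proj₁ (approx y)) (≤-trans Fy≤Fz (proj₂ (approx z))))

module _ {n k : ℕ} where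

  [≔]-lookup : (g : Orth n k) (u : Fin n) (v : Fin (suc k)) → (g [ u ≔ v ]) u ≡ v
  [≔]-lookup g u v with u Fin.≟ u
  ... | yes _ = refl
  ... | no u≢u = contradiction refl u≢u

  [≔]-lookup′ : (g : Orth n k) {u e : Fin n} (v : Fin (suc k)) → e ≢ u → (g [ u ≔ v ]) e ≡ g e
  [≔]-lookup′ g {u} {e} v e≢u with e Fin.≟ u
  ... | yes e≡u = contradiction e≡u e≢u
  ... | no _ = refl

  [≔]-restore : {y : Orth n k} {u : Fin n} {v : Fin (suc k)} (a : Fin (suc k)) →
                y u ≡ v → (y [ u ≔ a ]) [ u ≔ v ] ≗ y
  [≔]-restore {u = u} a yu≡v e with e Fin.≟ u
  ... | yes refl = sym yu≡v
  ... | no e≢u = [≔]-lookup′ _ a e≢u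

  𝟎≼ : {y : Orth n k} → 𝟎 ≼ y
  𝟎≼ _ 0≢0 = contradiction refl 0≢0

  ≗⇒≼ : {x y : Orth n k} → x ≗ y → x ≼ y
  ≗⇒≼ x≗y e _ = sym (x≗y e)

  [≔]-mono-≼ : {x y : Orth n k} {u : Fin n} {v : Fin (suc k)} → x ≼ y → (x [ u ≔ v ]) ≼ (y [ u ≔ v ])
  [≔]-mono-≼ {u = u} x≼y e xe≢0 with e Fin.≟ u
  ... | yes _ = refl
  ... | no _ = x≼y e xe≢0

  ≼-[≔] : {y : Orth n k} {u : Fin n} {v : Fin (suc k)} → y u ≡ zero → y ≼ (y [ u ≔ v ])
  ≼-[≔] {u = u} yu≡0 e ye≢0 with e Fin.≟ u
  ... | yes refl = contradiction yu≡0 ye≢0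
  ... | no _ = refl

  ≼-[≔0] : {x y : Orth n k} {u : Fin n} → x u ≡ zero → x ≼ y → x ≼ (y [ u ≔ zero ])
  ≼-[≔0] {u = u} xu≡0 x≼y e xe≢0 with e Fin.≟ u
  ... | yes refl = contradiction xu≡0 xe≢0
  ... | no _ = x≼y e xe≢0

≢zero⇒≡fsuc : ∀ {k} {a : Fin (suc k)} → a ≢ zero → ∃ λ i → a ≡ fsuc i
≢zero⇒≡fsuc {a = zero} a≢0 = contradiction refl a≢0
≢zero⇒≡fsuc {a = fsuc i} _ = i , refl

module _ (𝔽 : OrderedField) {n k : ℕ} {f : Orth n k → OrderedField.Carrier 𝔽} where
  open OrderedField 𝔽
  open OrderedFieldProperties 𝔽
  open ≤-Reasoning poset

  monotone-resp-≗ : IsMonotone 𝔽 f → {x y : Orth n k} → x ≗ y → f x ≡ f y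
  monotone-resp-≗ mono {x} {y} x≗y = antisym (mono x y (≗⇒≼ x≗y)) (mono y x (≗⇒≼ (λ e → sym (x≗y e))))

  exchange-loss≤marginal : IsKSubmodular 𝔽 f → IsMonotone 𝔽 f →
    {x h o′ : Orth n k} {u : Fin n} (i : Fin k) → x ≼ h → h u ≡ zero → h ≼ o′ →
    f (h [ u ≔ fsuc i ]) - f o′ ≤ Δ 𝔽 f u i x
  exchange-loss≤marginal (diminishing , _) mono {x} {h} {o′} {u} i x≼h hu≡0 h≼o′ = begin
    f (h [ u ≔ fsuc i ]) - f o′ ≤⟨ -‿antimonoʳ-≤ _ (mono h o′ h≼o′) ⟩
    Δ 𝔽 f u i h                 ≤⟨ diminishing x h x≼h u hu≡0 i ⟩
    Δ 𝔽 f u i x                 ∎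

lemma1 : (𝔽 : OrderedField) → let open OrderedField 𝔽 in
  (n k B : ℕ) → 1 Nat.≤ k → 1 Nat.≤ B → B Nat.≤ n →
  (ε : Carrier) → 0# < ε → ε < 1# →
  (F f : Orth n k → Carrier) →
  -- F : (k+1)^V → ℝ≥0, ε-approximately k-submodular with witness f
  ((y : Orth n k) → 0# ≤ F y) →
  IsKSubmodular 𝔽 f → IsMonotone 𝔽 f → f 𝟎 ≡ 0# →
  ((y : Orth n k) → (1# - ε) * f y ≤ F y × F y ≤ (1# + ε) * f y) →
  -- iterates x (j) and selected pairs (e j , ι j) of k-Greedy-TS on F
  -- (step j+1 selects e (suc j) ∉ supp (x j) and value fsuc (ι (suc j)))
  (x : ℕ → Orth n k) (e : ℕ → Fin n) (ι : ℕ → Fin k) →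
  x 0 ≡ 𝟎 →
  ((j : ℕ) → j Nat.< B →
     x j (e (suc j)) ≡ zero
     × ((e' : Fin n) (i : Fin k) → x j e' ≡ zero →
          Δ 𝔽 F e' i (x j) ≤ Δ 𝔽 F (e (suc j)) (ι (suc j)) (x j))
     × x (suc j) ≡ x j [ e (suc j) ≔ fsuc (ι (suc j)) ]) →
  -- o is an optimal solution of size exactly B
  (o : Orth n k) →
  ((y : Orth n k) → ∣supp∣ y Nat.≤ B → F y ≤ F o) →
  ∣supp∣ o ≡ B →
  -- the sequence o (j) = o^(j), oh (j) = o^(j-1/2), with removed elements u (j)
  (op oh : ℕ → Orth n k) (u : ℕ → Fin n) →
  op 0 ≡ o →
  ((j : ℕ) → j Nat.< B →
     (¬ (op j (u (suc j)) ≡ zero) × x j (u (suc j)) ≡ zero)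
     × ((¬ (op j (e (suc j)) ≡ zero) × x j (e (suc j)) ≡ zero) →
          u (suc j) ≡ e (suc j))
     × oh (suc j) ≡ op j [ u (suc j) ≔ zero ]
     × op (suc j) ≡ oh (suc j) [ e (suc j) ≔ fsuc (ι (suc j)) ]) →
  -- conclusion, for every step j+1 ∈ [B]
  (j : ℕ) → j Nat.< B →
  f (op j) - f (op (suc j))
    ≤ ((1# + ε) * (1# - ε) ⁻¹) * f (x (suc j)) - f (x j)
lemma1 𝔽 n k B _ _ _ ε _ ε<1 F f _ ksub mono _ approx x e ι x0 greedy o _ _ op oh u _ constr j j<B
  with greedy j j<B | constr j j<B
... | xe≡0 , gain≤ , xeq | (ou≢0 , xu≡0) , u≡e , oheq , opeq = begin
  f (op j) - f (op (suc j))
    ≡⟨ cong (_- f (op (suc j))) (monotone-resp-≗ 𝔽 mono op≗) ⟩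
  f (oh (suc j) [ u (suc j) ≔ fsuc i ]) - f (op (suc j))
    ≤⟨ exchange-loss≤marginal 𝔽 ksub mono i x≼oh oh-u≡0 oh≼op ⟩
  Δ 𝔽 f (u (suc j)) i (x j)
    ≤⟨ +-mono-≤ (- f (x j)) (approximation-transfers-≤ ε<1 approx gain) ⟩
  ((1# + ε) * (1# - ε) ⁻¹) * f (x (suc j)) - f (x j) ∎
  where
  open OrderedField 𝔽
  open OrderedFieldProperties 𝔽
  open ≤-Reasoning poset

  x≼op : ∀ m → m Nat.≤ B → x m ≼ op m
  x≼op 0 _ = subst (_≼ op 0) (sym x0) 𝟎≼
  x≼op (suc m) m<B with greedy m m<B | constr m m<B
  ... | _ , _ , xeq | (_ , xu≡0) , _ , oheq , opeq =
    subst₂ _≼_ (sym xeq) (sym (trans opeq (cong (_[ e (suc m) ≔ fsuc (ι (suc m)) ]) oheq)))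
      ([≔]-mono-≼ (≼-[≔0] xu≡0 (x≼op m (<⇒≤ m<B))))

  i : Fin k
  i = proj₁ (≢zero⇒≡fsuc ou≢0)

  op≗ : op j ≗ (oh (suc j) [ u (suc j) ≔ fsuc i ])
  op≗ e′ = sym (subst (λ h → (h [ u (suc j) ≔ fsuc i ]) e′ ≡ op j e′) (sym oheq)
                  ([≔]-restore zero (proj₂ (≢zero⇒≡fsuc ou≢0)) e′))

  x≼oh : x j ≼ oh (suc j)
  x≼oh = subst (x j ≼_) (sym oheq) (≼-[≔0] xu≡0 (x≼op j (<⇒≤ j<B)))

  oh-u≡0 : oh (suc j) (u (suc j)) ≡ zero
  oh-u≡0 = trans (cong (λ h → h (u (suc j))) oheq) ([≔]-lookup (op j) (u (suc j)) zero)

  -- e^(j) is either the removed u_j, or outside supp o^(j-1): otherwise it would have been u_j.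
  oh-e≡0 : oh (suc j) (e (suc j)) ≡ zero
  oh-e≡0 with e (suc j) Fin.≟ u (suc j) | op j (e (suc j)) Fin.≟ zero
  ... | yes e≡u | _ = subst (λ v → oh (suc j) v ≡ zero) (sym e≡u) oh-u≡0
  ... | no e≢u | yes oe≡0 =
    trans (cong (λ h → h (e (suc j))) oheq) (trans ([≔]-lookup′ (op j) zero e≢u) oe≡0)
  ... | no e≢u | no oe≢0 = contradiction (sym (u≡e (oe≢0 , xe≡0))) e≢u

  oh≼op : oh (suc j) ≼ op (suc j)
  oh≼op = subst (oh (suc j) ≼_) (sym opeq) (≼-[≔] oh-e≡0)

  gain : F (x j [ u (suc j) ≔ fsuc i ]) ≤ F (x (suc j))
  gain = x-z≤y-z⇒x≤y (F (x j))
    (subst (λ y → Δ 𝔽 F (u (suc j)) i (x j) ≤ F y - F (x j)) (sym xeq) (gain≤ (u (suc j)) i xu≡0))
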